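{- For every connected graph $G$ of order $n$ and every graph $H$ of radius $r(H)\ge 4$, $$\dim_l(G\odot H)=n\cdot\dim_l(K_1+H).$$
   Context: All graphs are finite and simple. For a connected graph $X$, $d_X(x,y)$ is the length of a shortest path between $x$ and $y$. A vertex $w$ distinguishes two vertices $x,y$ if $d_X(w,x)\ne d_X(w,y)$. A set $S\subseteq V(X)$ is a local metric generator for $X$ if every two adjacent vertices of $X$ are distinguished by some vertex of $S$; a local metric generator of minimum cardinality is a local metric basis, and its cardinality is the local metric dimension $\dim_l(X)$. For a graph $G$ of order $n$ with vertices $v_1,\dots,v_n$ and a graph $H$, the corona product $G\odot H$ is obtained from one copy of $G$ and $n$ disjoint copies $H_1,\dots,H_n$ of $H$ by joining $v_i$ by an edge to every vertex of $H_i$. The join $K_1+H$ is obtained from $H$ by adding one new vertex adjacent to every vertex of $H$. The radius $r(H)$ is the minimum eccentricity of a vertex of $H$. -}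

module Defs where

open import Data.Nat using (ℕ; zero; suc; _≤_)
open import Data.Fin using (Fin)
open import Data.Product using (Σ; ∃; _×_; _,_)
open import Data.Sum using (_⊎_; inj₁; inj₂)
open import Data.Unit using (⊤; tt)
open import Data.Empty using (⊥)
open import Data.List using (List; length)
open import Data.List.Membership.Propositional using (_∈_)
open import Data.List.Relation.Unary.Unique.Propositional using (Unique)
open import Relation.Nullary using (¬_)
open import Relation.Binary.PropositionalEquality using (_≡_; _≢_)

record Graph (V : Set) : Set₁ where
  field
    Adj   : V → V → Set
    sym   : ∀ {x y} → Adj x y → Adj y x
    irrefl : ∀ {x} → ¬ Adj x x
open Graph public

module _ {V : Set} (X : Graph V) where

  data Walk : V → V → ℕ → Set where
    here : ∀ {x} → Walk x x zero
    step : ∀ {x y z k} → Adj X x y → Walk y z k → Walk x z (suc k)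

  Connected : Set
  Connected = ∀ x y → ∃ λ k → Walk x y k

  Dist : V → V → ℕ → Set
  Dist x y k = Walk x y k × (∀ m → Walk x y m → k ≤ m)

  Distinguishes : V → V → V → Set
  Distinguishes w x y = ∀ a b → Dist w x a → Dist w y b → a ≢ b

  -- a vertex set S is represented by a duplicate-free list; |S| = length
  IsLocalMetricGenerator : List V → Set
  IsLocalMetricGenerator S =
    ∀ x y → Adj X x y → Σ V λ w → w ∈ S × Distinguishes w x y

  IsLocalMetricDim : ℕ → Set
  IsLocalMetricDim k =
    (Σ (List V) λ S → Unique S × IsLocalMetricGenerator S × length S ≡ k)
    × (∀ S → Unique S → IsLocalMetricGenerator S → k ≤ length S)

  IsEcc : V → ℕ → Set
  IsEcc v e = (∀ u k → Dist v u k → k ≤ e) × (Σ V λ u → Dist v u e)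

  IsRadius : ℕ → Set
  IsRadius r = (Σ V λ v → IsEcc v r) × (∀ v e → IsEcc v e → r ≤ e)

-- corona product G ⊙ H; vertex inj₁ i is v_i of G, inj₂ (i , a) is vertex a of copy H_i
coronaAdj : ∀ {n m} → Graph (Fin n) → Graph (Fin m)
          → (Fin n ⊎ (Fin n × Fin m)) → (Fin n ⊎ (Fin n × Fin m)) → Set
coronaAdj G H (inj₁ i) (inj₁ j) = Adj G i j
coronaAdj G H (inj₁ i) (inj₂ (j , b)) = i ≡ j
coronaAdj G H (inj₂ (i , a)) (inj₁ j) = i ≡ j
coronaAdj G H (inj₂ (i , a)) (inj₂ (j , b)) = i ≡ j × Adj H a b

corona : ∀ {n m} → Graph (Fin n) → Graph (Fin m) → Graph (Fin n ⊎ (Fin n × Fin m))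
corona G H = record { Adj = coronaAdj G H ; sym = λ {x} {y} → s {x} {y} ; irrefl = λ {x} → ir {x} }
  where
  open import Relation.Binary.PropositionalEquality using (refl)
  s : ∀ {x y} → coronaAdj G H x y → coronaAdj G H y x
  s {inj₁ i} {inj₁ j} p = sym G p
  s {inj₁ i} {inj₂ _} refl = refl
  s {inj₂ _} {inj₁ j} refl = refl
  s {inj₂ _} {inj₂ _} (refl , p) = refl , sym H p
  ir : ∀ {x} → ¬ coronaAdj G H x x
  ir {inj₁ i} p = irrefl G p
  ir {inj₂ _} (_ , p) = irrefl H p

-- join K₁ + H; inj₁ tt is the new vertex
joinAdj : ∀ {V} → Graph V → (⊤ ⊎ V) → (⊤ ⊎ V) → Set
joinAdj H (inj₁ _) (inj₁ _) = ⊥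
joinAdj H (inj₁ _) (inj₂ _) = ⊤
joinAdj H (inj₂ _) (inj₁ _) = ⊤
joinAdj H (inj₂ a) (inj₂ b) = Adj H a b

K₁+ : ∀ {V} → Graph V → Graph (⊤ ⊎ V)
K₁+ H = record { Adj = joinAdj H ; sym = λ {x} {y} → s {x} {y} ; irrefl = λ {x} → ir {x} }
  where
  s : ∀ {x y} → joinAdj H x y → joinAdj H y x
  s {inj₁ _} {inj₁ _} ()
  s {inj₁ _} {inj₂ _} p = tt
  s {inj₂ _} {inj₁ _} p = tt
  s {inj₂ _} {inj₂ _} p = sym H p
  ir : ∀ {x} → ¬ joinAdj H x x
  ir {inj₁ _} ()
  ir {inj₂ _} p = irrefl H p

-- The copy v_i + H_i of K₁ + H sits isometrically inside G ⊙ H, while a vertex outside H_i sees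
-- all of H_i at the same distance, since every path into H_i enters through v_i. So lifting a
-- local metric basis of K₁ + H to all n copies gives a local metric generator of G ⊙ H (the ends
-- of an edge of G are distinguished by any lifted vertex), and conversely every local metric
-- generator of G ⊙ H restricts, on each copy, to a set distinguishing all edges of H. When
-- r(H) ≥ 4 such a set also distinguishes the apex from every vertex a of H: otherwise all its
-- vertices are neighbours of a, and as they distinguish the edges of H, every vertex of H would
-- lie within distance 3 of a.
--
-- Adjacency need not be decidable, so case distinctions on it are made under double negation;
-- every conclusion drawn from them is negative (distinguishing) or decidable (an inequality).

module Submission where

open import Defs
open import Data.Nat using (ℕ; zero; suc; _+_; _*_; _≤_; _<_; z≤n; s≤s; _≤?_)
open import Data.Nat.Properties
  using (≤-antisym; ≤-refl; ≤-trans; ≮⇒≥; <-irrefl; +-mono-≤; ≤-totalOrder; +-0-commutativeMonoid)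
open import Data.Nat.Induction using (<-rec)
open import Data.Fin using (Fin; zero; suc)
open import Data.Fin.Properties using (_≟_)
open import Data.Product using (Σ; ∃; _×_; _,_; proj₁; proj₂; map₂; swap)
open import Data.Sum using (_⊎_; inj₁; inj₂)
open import Data.Unit using (⊤; tt)
open import Data.Empty using (⊥-elim)
open import Data.Bool using (if_then_else_; true; false)
open import Data.List using (List; []; _∷_; length; map; filter; cartesianProductWith; allFin)
open import Data.List.Properties using (length-map; length-++; length-tabulate)
open import Data.List.Extrema ≤-totalOrder using (argmax; f[xs]≤f[argmax])
open import Data.List.Membership.Propositional using (_∈_)
open import Data.List.Membership.Propositional.Properties
  using (∈-map⁺; ∈-filter⁺; ∈-allFin; ∈-cartesianProductWith⁺)
open import Data.List.Relation.Unary.All as All using (All; []; _∷_)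
open import Data.List.Relation.Unary.All.Properties using (all-filter) renaming (map⁺ to All-map⁺)
open import Data.List.Relation.Unary.Unique.Propositional using (Unique; []; _∷_)
open import Data.List.Relation.Unary.Unique.Propositional.Properties
  using (cartesianProductWith⁺; allFin⁺; filter⁺)
open import Algebra.Properties.CommutativeMonoid.Sum +-0-commutativeMonoid
  using (sum; sum-syntax; ∑-distrib-+; sum-cong-≗; sum-replicate-zero)
open import Function using (_∘_; id)
open import Relation.Nullary using (¬_; yes; no; does)
open import Relation.Nullary.Negation using (¬¬-map)
open import Relation.Nullary.Decidable using (decidable-stable; ¬¬-excluded-middle)
open import Relation.Binary.PropositionalEquality
  using (_≡_; _≢_; refl; trans; cong; cong₂; subst; module ≡-Reasoning)
  renaming (sym to ≡-sym)

¬¬-pull-Fin : ∀ {k} {P : Fin k → Set} → (∀ i → ¬ ¬ P i) → ¬ ¬ (∀ i → P i)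
¬¬-pull-Fin {zero}  _   all = all λ ()
¬¬-pull-Fin {suc k} ¬¬P all =
  ¬¬P zero λ P₀ → ¬¬-pull-Fin (¬¬P ∘ suc) λ Pₛ → all λ { zero → P₀ ; (suc i) → Pₛ i }

Least : (ℕ → Set) → Set
Least P = Σ ℕ λ d → P d × (∀ j → P j → d ≤ j)

¬¬-least : (P : ℕ → Set) {k : ℕ} → P k → ¬ ¬ Least P
¬¬-least P {k} = <-rec (λ k → P k → ¬ ¬ Least P) least k
  where
  least : ∀ k → (∀ {j} → j < k → P j → ¬ ¬ Least P) → P k → ¬ ¬ Least P
  least k below Pk ¬least = ¬¬-excluded-middle {A = Σ ℕ λ j → j < k × P j} λ where
    (yes (j , j<k , Pj)) → below j<k Pj ¬least
    (no none)            → ¬least (k , Pk , λ j Pj → ≮⇒≥ λ j<k → none (j , j<k , Pj))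

module _ {A B : Set} where

  Unique-map⁺-on : ∀ {P : A → Set} {f : A → B} {xs}
                 → (∀ {x y} → P x → P y → f x ≡ f y → x ≡ y)
                 → All P xs → Unique xs → Unique (map f xs)
  Unique-map⁺-on inj []         []          = []
  Unique-map⁺-on inj (Px ∷ Pxs) (x∉ ∷ uxs) =
    All-map⁺ (All.zipWith (λ (x≢y , Py) fx≡fy → x≢y (inj Px Py fx≡fy)) (x∉ , Pxs))
    ∷ Unique-map⁺-on inj Pxs uxs

  length-cartesianProductWith : ∀ {C : Set} (f : A → B → C) xs ys
    → length (cartesianProductWith f xs ys) ≡ length xs * length ys
  length-cartesianProductWith f []       ys = refl
  length-cartesianProductWith f (x ∷ xs) ys =
    trans (length-++ (map (f x) ys))
          (cong₂ _+_ (length-map (f x) ys) (length-cartesianProductWith f xs ys))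

∑-lowerBound : ∀ {n b} (f : Fin n → ℕ) → (∀ i → b ≤ f i) → n * b ≤ sum f
∑-lowerBound {zero}  f b≤f = z≤n
∑-lowerBound {suc n} f b≤f = +-mono-≤ (b≤f zero) (∑-lowerBound (f ∘ suc) (b≤f ∘ suc))

indicator : ∀ {n} → Fin n → Fin n → ℕ
indicator j i = if does (j ≟ i) then 1 else 0

∑-indicator : ∀ {n} (j : Fin n) → ∑[ i < n ] indicator j i ≡ 1
∑-indicator {suc n} zero    = cong suc (sum-replicate-zero n)
∑-indicator {suc n} (suc j) = ∑-indicator j

module _ {A : Set} {n} (f : A → Fin n) where

  fibre : Fin n → List A → List A
  fibre i = filter (λ x → f x ≟ i)

  length-fibre-∷ : ∀ x xs i → length (fibre i (x ∷ xs)) ≡ indicator (f x) i + length (fibre i xs)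
  length-fibre-∷ x xs i with does (f x ≟ i)
  ... | true  = refl
  ... | false = refl

  ∑-length-fibre : ∀ xs → ∑[ i < n ] length (fibre i xs) ≡ length xs
  ∑-length-fibre []       = sum-replicate-zero n
  ∑-length-fibre (x ∷ xs) = begin
    ∑[ i < n ] length (fibre i (x ∷ xs))                           ≡⟨ sum-cong-≗ (length-fibre-∷ x xs) ⟩
    ∑[ i < n ] (indicator (f x) i + length (fibre i xs))           ≡⟨ ∑-distrib-+ (indicator (f x)) _ ⟩
    ∑[ i < n ] indicator (f x) i + ∑[ i < n ] length (fibre i xs)  ≡⟨ cong₂ _+_ (∑-indicator (f x)) (∑-length-fibre xs) ⟩
    suc (length xs)                                                ∎
    where open ≡-Reasoning

module _ {V : Set} (X : Graph V) where

  walk-zero : ∀ {x y} → Walk X x y 0 → x ≡ y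
  walk-zero here = refl

  walk-one : ∀ {x y} → Walk X x y 1 → Adj X x y
  walk-one (step x~y here) = x~y

  walk-snoc : ∀ {x y z k} → Walk X x y k → Adj X y z → Walk X x z (suc k)
  walk-snoc here       y~z = step y~z here
  walk-snoc (step e w) y~z = step e (walk-snoc w y~z)

  adjacent⇒≢ : ∀ {x y} → Adj X x y → x ≢ y
  adjacent⇒≢ x~y refl = irrefl X x~y

  Within : ℕ → V → V → Set
  Within e x y = Σ ℕ λ L → Walk X x y L × L ≤ e

  Dist-unique : ∀ {x y k k′} → Dist X x y k → Dist X x y k′ → k ≡ k′
  Dist-unique (w , least) (w′ , least′) = ≤-antisym (least _ w′) (least′ _ w)

  dist-0 : ∀ {x} → Dist X x x 0
  dist-0 = here , λ _ _ → z≤n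

  dist-1 : ∀ {x y} → Adj X x y → Dist X x y 1
  dist-1 {x} {y} x~y = step x~y here , least
    where
    least : ∀ j → Walk X x y j → 1 ≤ j
    least zero    w = ⊥-elim (adjacent⇒≢ x~y (walk-zero w))
    least (suc j) w = s≤s z≤n

  dist-2 : ∀ {x y z} → x ≢ y → ¬ Adj X x y → Adj X x z → Adj X z y → Dist X x y 2
  dist-2 {x} {y} x≢y x≁y x~z z~y = step x~z (step z~y here) , least
    where
    least : ∀ j → Walk X x y j → 2 ≤ j
    least zero          w = ⊥-elim (x≢y (walk-zero w))
    least (suc zero)    w = ⊥-elim (x≁y (walk-one w))
    least (suc (suc j)) w = s≤s (s≤s z≤n)

  ¬¬-dist : ∀ {x y k} → Walk X x y k → ¬ ¬ ∃ (Dist X x y)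
  ¬¬-dist = ¬¬-least (Walk X _ _)

  distinguishes-by-dist : ∀ {w x y p q} → Dist X w x p → Dist X w y q → p ≢ q → Distinguishes X w x y
  distinguishes-by-dist dx dy p≢q a b da db a≡b =
    p≢q (trans (Dist-unique dx da) (trans a≡b (Dist-unique db dy)))

  distinguishes-sym : ∀ {w x y} → Distinguishes X w x y → Distinguishes X w y x
  distinguishes-sym D a b da db a≡b = D b a db da (≡-sym a≡b)

  has-neighbour : Connected X → ∀ {x y} → x ≢ y → ∃ (Adj X x)
  has-neighbour connected {x} {y} x≢y with connected x y
  ... | zero  , w              = ⊥-elim (x≢y (walk-zero w))
  ... | suc _ , step x~z _     = _ , x~z

distinguishes-transfer : ∀ {V W} (X : Graph V) (Y : Graph W) {w x₁ x₂ w′ y₁ y₂}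
  → ¬ ¬ (Σ ℕ λ p → Dist X w x₁ p × Dist Y w′ y₁ p)
  → ¬ ¬ (Σ ℕ λ p → Dist X w x₂ p × Dist Y w′ y₂ p)
  → Distinguishes X w x₁ x₂ → Distinguishes Y w′ y₁ y₂
distinguishes-transfer X Y same₁ same₂ D a b da db a≡b =
  same₁ λ (p₁ , dX₁ , dY₁) → same₂ λ (p₂ , dX₂ , dY₂) →
    D p₁ p₂ dX₁ dX₂ (trans (Dist-unique Y dY₁ da) (trans a≡b (Dist-unique Y db dY₂)))

module _ {k} (X : Graph (Fin k)) where

  Apart : Fin k → Fin k → Set
  Apart x y = x ≢ y × ¬ Adj X x y

  ¬¬-trichotomy : ∀ x y → ¬ ¬ (x ≡ y ⊎ Adj X x y ⊎ Apart x y)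
  ¬¬-trichotomy x y tri with x ≟ y
  ... | yes x≡y = tri (inj₁ x≡y)
  ... | no  x≢y = ¬¬-excluded-middle {A = Adj X x y} λ where
    (yes x~y) → tri (inj₂ (inj₁ x~y))
    (no  x≁y) → tri (inj₂ (inj₂ (x≢y , x≁y)))

  ¬¬-eccentricity : Connected X → ∀ a → ¬ ¬ ∃ (IsEcc X a)
  ¬¬-eccentricity connected a =
    ¬¬-map eccentricity (¬¬-pull-Fin λ u → ¬¬-dist X (proj₂ (connected a u)))
    where
    eccentricity : (∀ u → ∃ (Dist X a u)) → ∃ (IsEcc X a)
    eccentricity dist = proj₁ (dist far) , bounded , far , proj₂ (dist far)
      where
      far : Fin k
      far = argmax (proj₁ ∘ dist) a (allFin k)
      bounded : ∀ u d → Dist X a u d → d ≤ proj₁ (dist far)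
      bounded u d a↝u = subst (_≤ proj₁ (dist far)) (Dist-unique X (proj₂ (dist u)) a↝u)
                              (All.lookup (f[xs]≤f[argmax] a (allFin k)) (∈-allFin u))

  eccentricity≤reach : ∀ {a ecc e} → IsEcc X a ecc → (∀ u → Within X e a u) → ecc ≤ e
  eccentricity≤reach (_ , u , _ , least) reach =
    let L , a↝u , L≤e = reach u in ≤-trans (least L a↝u) L≤e

  radius≤reach : Connected X → ∀ {r e a} → IsRadius X r → (∀ u → ¬ ¬ Within X e a u) → r ≤ e
  radius≤reach connected {r} {e} {a} (_ , r-least) reach = decidable-stable (r ≤? e) λ r≰e →
    ¬¬-eccentricity connected a λ (ecc , isEcc) → ¬¬-pull-Fin reach λ near →
      r≰e (≤-trans (r-least a ecc isEcc) (eccentricity≤reach isEcc near))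

module Join {m} (H : Graph (Fin m)) where

  K : Graph (⊤ ⊎ Fin m)
  K = K₁+ H

  root : ⊤ ⊎ Fin m
  root = inj₁ tt

  dist-root : ∀ {a} → Dist K root (inj₂ a) 1
  dist-root = dist-1 K tt

  dist-to-root : ∀ {a} → Dist K (inj₂ a) root 1
  dist-to-root = dist-1 K tt

  dist-apart : ∀ {x y} → Apart H x y → Dist K (inj₂ x) (inj₂ y) 2
  dist-apart (x≢y , x≁y) = dist-2 K {z = root} (λ { refl → x≢y refl }) x≁y tt tt

  non-distinguisher-adjacent : ∀ {s a} → ¬ Distinguishes K s root (inj₂ a)
                             → ¬ ¬ (Σ (Fin m) λ c → s ≡ inj₂ c × Adj H c a)
  non-distinguisher-adjacent {inj₁ tt} nd _ =
    nd (distinguishes-by-dist K (dist-0 K) dist-root (λ ()))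
  non-distinguisher-adjacent {inj₂ c} {a} nd adjacent = ¬¬-trichotomy H c a λ where
    (inj₁ refl)         → nd (distinguishes-by-dist K dist-to-root (dist-0 K) (λ ()))
    (inj₂ (inj₁ c~a))   → adjacent (c , refl , c~a)
    (inj₂ (inj₂ apart)) → nd (distinguishes-by-dist K dist-to-root (dist-apart apart) (λ ()))

  distinguisher-near : ∀ {c u y} → Adj H u y → Distinguishes K (inj₂ c) (inj₂ u) (inj₂ y)
                     → ¬ ¬ Within H 2 c u
  distinguisher-near {c} {u} {y} u~y D near = ¬¬-trichotomy H c u λ where
    (inj₁ refl)           → near (0 , here , z≤n)
    (inj₂ (inj₁ c~u))     → near (1 , step c~u here , s≤s z≤n)
    (inj₂ (inj₂ apart-u)) → ¬¬-trichotomy H c y λ where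
      (inj₁ refl)           → near (1 , step (sym H u~y) here , s≤s z≤n)
      (inj₂ (inj₁ c~y))     → near (2 , step c~y (step (sym H u~y) here) , ≤-refl)
      (inj₂ (inj₂ apart-y)) → D 2 2 (dist-apart apart-u) (dist-apart apart-y) refl

  DistinguishesEdgesOfH : List (⊤ ⊎ Fin m) → Set
  DistinguishesEdgesOfH T =
    ∀ x y → Adj H x y → Σ (⊤ ⊎ Fin m) λ s → s ∈ T × Distinguishes K s (inj₂ x) (inj₂ y)

  module _ (connected : Connected H) {r} (radius : IsRadius H r) (4≤r : 4 ≤ r) where

    root-distinguished : ∀ {T} → DistinguishesEdgesOfH T
                       → ∀ a → ¬ ¬ (Σ (⊤ ⊎ Fin m) λ s → s ∈ T × Distinguishes K s root (inj₂ a))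
    root-distinguished {T} distinguishes a undistinguished =
      <-irrefl refl (≤-trans 4≤r (radius≤reach H connected radius reach))
      where
      reach : ∀ u → ¬ ¬ Within H 3 a u
      reach u near with u ≟ a
      ... | yes refl = near (0 , here , z≤n)
      ... | no  u≢a with has-neighbour H connected u≢a
      ...   | y , u~y with distinguishes u y u~y
      ...     | s , s∈T , D =
        non-distinguisher-adjacent (λ D′ → undistinguished (s , s∈T , D′)) λ where
          (c , refl , c~a) → distinguisher-near u~y D λ where
            (L , c↝u , L≤2) → near (suc L , step (sym H c~a) c↝u , s≤s L≤2)

    ¬¬-generator : ∀ {T} → DistinguishesEdgesOfH T → ¬ ¬ IsLocalMetricGenerator K T
    ¬¬-generator {T} distinguishes isGenerator =
      ¬¬-pull-Fin (root-distinguished distinguishes) (isGenerator ∘ generator)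
      where
      generator : (∀ a → Σ (⊤ ⊎ Fin m) λ s → s ∈ T × Distinguishes K s root (inj₂ a))
                → IsLocalMetricGenerator K T
      generator rootD (inj₁ _) (inj₁ _) ()
      generator rootD (inj₁ _) (inj₂ a) _   = rootD a
      generator rootD (inj₂ a) (inj₁ _) _   = map₂ (map₂ (distinguishes-sym K)) (rootD a)
      generator rootD (inj₂ x) (inj₂ y) x~y = distinguishes x y x~y

module Corona {n m} (G : Graph (Fin n)) (H : Graph (Fin m)) where

  open Join H

  C : Graph (Fin n ⊎ (Fin n × Fin m))
  C = corona G H

  copy : Fin n → ⊤ ⊎ Fin m → Fin n ⊎ (Fin n × Fin m)
  copy i (inj₁ _) = inj₁ i
  copy i (inj₂ a) = inj₂ (i , a)

  index : Fin n ⊎ (Fin n × Fin m) → Fin n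
  index (inj₁ i)       = i
  index (inj₂ (i , _)) = i

  point : Fin n ⊎ (Fin n × Fin m) → ⊤ ⊎ Fin m
  point (inj₁ _)       = root
  point (inj₂ (_ , a)) = inj₂ a

  copy-index-point : ∀ w → copy (index w) (point w) ≡ w
  copy-index-point (inj₁ _) = refl
  copy-index-point (inj₂ _) = refl

  copy-injective : ∀ {i j s t} → copy i s ≡ copy j t → i ≡ j × s ≡ t
  copy-injective {s = inj₁ _} {inj₁ _} refl = refl , refl
  copy-injective {s = inj₂ _} {inj₂ _} refl = refl , refl

  ¬¬-copy-dist : ∀ i s t → ¬ ¬ (Σ ℕ λ p → Dist K s t p × Dist C (copy i s) (copy i t) p)
  ¬¬-copy-dist i (inj₁ _) (inj₁ _) same = same (0 , dist-0 K , dist-0 C)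
  ¬¬-copy-dist i (inj₁ _) (inj₂ _) same = same (1 , dist-root , dist-1 C refl)
  ¬¬-copy-dist i (inj₂ _) (inj₁ _) same = same (1 , dist-to-root , dist-1 C refl)
  ¬¬-copy-dist i (inj₂ c) (inj₂ x) same = ¬¬-trichotomy H c x λ where
    (inj₁ refl)         → same (0 , dist-0 K , dist-0 C)
    (inj₂ (inj₁ c~x))   → same (1 , dist-1 K c~x , dist-1 C (refl , c~x))
    (inj₂ (inj₂ apart)) → same (2 , dist-apart apart , dist-2 C {z = inj₁ i}
                                 (λ { refl → proj₁ apart refl }) (proj₂ apart ∘ proj₂) refl refl)

  distinguishes-copy⁺ : ∀ i {s t t′} → Distinguishes K s t t′
                      → Distinguishes C (copy i s) (copy i t) (copy i t′)
  distinguishes-copy⁺ i = distinguishes-transfer K C (¬¬-copy-dist i _ _) (¬¬-copy-dist i _ _)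

  distinguishes-copy⁻ : ∀ i {s t t′} → Distinguishes C (copy i s) (copy i t) (copy i t′)
                      → Distinguishes K s t t′
  distinguishes-copy⁻ i = distinguishes-transfer C K
    (¬¬-map (map₂ swap) (¬¬-copy-dist i _ _)) (¬¬-map (map₂ swap) (¬¬-copy-dist i _ _))

  OutsideH : Fin n → Fin n ⊎ (Fin n × Fin m) → Set
  OutsideH i w = ∀ a → w ≢ inj₂ (i , a)

  adjacent-to-H⇒root : ∀ {i w a} → OutsideH i w → Adj C w (inj₂ (i , a)) → w ≡ inj₁ i
  adjacent-to-H⇒root {w = inj₁ _}       _   refl       = refl
  adjacent-to-H⇒root {w = inj₂ (_ , c)} out (refl , _) = ⊥-elim (out c refl)

  enters-H-through-root : ∀ {i w a M} → OutsideH i w → Walk C w (inj₂ (i , a)) M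
                        → Σ ℕ λ L → Walk C w (inj₁ i) L × L < M
  enters-H-through-root out here = ⊥-elim (out _ refl)
  enters-H-through-root {i} out (step {y = inj₁ j} e rest)
    with L , w , L<M ← enters-H-through-root {i} (λ _ ()) rest = suc L , step e w , s≤s L<M
  enters-H-through-root {i} out (step {y = inj₂ (j , c)} e rest) with j ≟ i
  ... | yes refl = 0 , subst (λ v → Walk C v (inj₁ i) 0) (≡-sym (adjacent-to-H⇒root out e)) here , s≤s z≤n
  ... | no  j≢i with L , w , L<M ← enters-H-through-root (λ { _ refl → j≢i refl }) rest =
    suc L , step e w , s≤s L<M

  dist-into-H : ∀ {i w a d} → OutsideH i w → Dist C w (inj₁ i) d → Dist C w (inj₂ (i , a)) (suc d)
  dist-into-H out (w↝vᵢ , least) = walk-snoc C w↝vᵢ refl , λ M w↝a →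
    let L , w↝vᵢ′ , L<M = enters-H-through-root out w↝a in ≤-trans (s≤s (least L w↝vᵢ′)) L<M

  lift-walk : ∀ {i j k} → Walk G i j k → Walk C (inj₁ i) (inj₁ j) k
  lift-walk here       = here
  lift-walk (step e w) = step e (lift-walk w)

  module _ (connected : Connected G) where

    walk-to-root : ∀ w i → ∃ (Walk C w (inj₁ i))
    walk-to-root (inj₁ j)       i = map₂ lift-walk (connected j i)
    walk-to-root (inj₂ (j , _)) i = let k , w = connected j i in suc k , step refl (lift-walk w)

    outside-indistinguishable : ∀ {i w} → OutsideH i w → ∀ a b → ¬ Distinguishes C w (inj₂ (i , a)) (inj₂ (i , b))
    outside-indistinguishable {i} {w} out a b D = ¬¬-dist C (proj₂ (walk-to-root w i)) λ (d , w↝vᵢ) →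
      D (suc d) (suc d) (dist-into-H out w↝vᵢ) (dist-into-H out w↝vᵢ) refl

  restrict : Fin n → List (Fin n ⊎ (Fin n × Fin m)) → List (⊤ ⊎ Fin m)
  restrict i S = map point (fibre index i S)

  ∈-restrict : ∀ {i w S} → w ∈ S → index w ≡ i → point w ∈ restrict i S
  ∈-restrict w∈S refl = ∈-map⁺ point (∈-filter⁺ (λ x → index x ≟ _) w∈S refl)

  restrict-unique : ∀ i {S} → Unique S → Unique (restrict i S)
  restrict-unique i {S} unique =
    Unique-map⁺-on point-injective (all-filter (λ x → index x ≟ i) S) (filter⁺ (λ x → index x ≟ i) unique)
    where
    point-injective : ∀ {x y} → index x ≡ i → index y ≡ i → point x ≡ point y → x ≡ y
    point-injective {x} {y} ix≡i iy≡i px≡py = begin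
      x                           ≡⟨ copy-index-point x ⟨
      copy (index x) (point x)    ≡⟨ cong₂ copy (trans ix≡i (≡-sym iy≡i)) px≡py ⟩
      copy (index y) (point y)    ≡⟨ copy-index-point y ⟩
      y                           ∎
      where open ≡-Reasoning

  ∑-length-restrict : ∀ S → ∑[ i < n ] length (restrict i S) ≡ length S
  ∑-length-restrict S =
    trans (sum-cong-≗ (λ i → length-map point (fibre index i S))) (∑-length-fibre index S)

  restrict-distinguishes-edges : Connected G → ∀ i {S} → IsLocalMetricGenerator C S
                               → DistinguishesEdgesOfH (restrict i S)
  restrict-distinguishes-edges connected i generator x y x~y
    with w , w∈S , D ← generator (inj₂ (i , x)) (inj₂ (i , y)) (refl , x~y)
    with index w ≟ i
  ... | yes refl = point w , ∈-restrict w∈S refl , distinguishes-copy⁻ i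
          (subst (λ v → Distinguishes C v (inj₂ (i , x)) (inj₂ (i , y))) (≡-sym (copy-index-point w)) D)
  ... | no  iw≢i = ⊥-elim (outside-indistinguishable connected (λ a w≡ → iw≢i (cong index w≡)) x y D)

  lower-bound : Connected G → Connected H → ∀ {r} → IsRadius H r → 4 ≤ r
              → ∀ {b} → (∀ T → Unique T → IsLocalMetricGenerator K T → b ≤ length T)
              → ∀ {S} → Unique S → IsLocalMetricGenerator C S → n * b ≤ length S
  lower-bound connectedG connectedH radius 4≤r {b} b-least {S} unique generator =
    subst (n * b ≤_) (∑-length-restrict S) (∑-lowerBound _ b≤restrict)
    where
    b≤restrict : ∀ i → b ≤ length (restrict i S)
    b≤restrict i = decidable-stable (b ≤? _) λ b≰ →
      ¬¬-generator connectedH radius 4≤r (restrict-distinguishes-edges connectedG i generator)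
        λ generatorᵢ → b≰ (b-least _ (restrict-unique i unique) generatorᵢ)

  copies : List (⊤ ⊎ Fin m) → List (Fin n ⊎ (Fin n × Fin m))
  copies = cartesianProductWith copy (allFin n)

  ∈-copies : ∀ {i s S} → s ∈ S → copy i s ∈ copies S
  ∈-copies s∈S = ∈-cartesianProductWith⁺ copy (∈-allFin _) s∈S

  copies-unique : ∀ {S} → Unique S → Unique (copies S)
  copies-unique = cartesianProductWith⁺ copy copy-injective (allFin⁺ n)

  length-copies : ∀ S → length (copies S) ≡ n * length S
  length-copies S = trans (length-cartesianProductWith copy (allFin n) S)
                          (cong (_* length S) (length-tabulate {n = n} id))

  distinguishes-G-edge : ∀ {i j} s → Adj G i j → Distinguishes C (copy i s) (inj₁ i) (inj₁ j)
  distinguishes-G-edge (inj₁ _) i~j = distinguishes-by-dist C (dist-0 C) (dist-1 C i~j) (λ ())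
  distinguishes-G-edge {i} (inj₂ _) i~j = distinguishes-by-dist C (dist-1 C refl)
    (dist-2 C {z = inj₁ i} (λ ()) (λ { refl → adjacent⇒≢ G i~j refl }) refl i~j) (λ ())

  lift-to-copy : ∀ i {S t t′} → Σ (⊤ ⊎ Fin m) (λ s → s ∈ S × Distinguishes K s t t′)
               → Σ (Fin n ⊎ (Fin n × Fin m)) λ w → w ∈ copies S × Distinguishes C w (copy i t) (copy i t′)
  lift-to-copy i (s , s∈S , D) = copy i s , ∈-copies s∈S , distinguishes-copy⁺ i D

  -- The vertex of H forces S to be nonempty; without a vertex in every copy the ends of the
  -- edges of G would not be distinguished.
  copies-generator : Fin m → ∀ {S} → IsLocalMetricGenerator K S → IsLocalMetricGenerator C (copies S)
  copies-generator v generator (inj₁ i) (inj₁ j) i~j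
    with s₀ , s₀∈S , _ ← generator root (inj₂ v) tt = copy i s₀ , ∈-copies s₀∈S , distinguishes-G-edge s₀ i~j
  copies-generator v generator (inj₁ i) (inj₂ (_ , a)) refl = lift-to-copy i (generator root (inj₂ a) tt)
  copies-generator v generator (inj₂ (i , a)) (inj₁ _) refl = lift-to-copy i (generator (inj₂ a) root tt)
  copies-generator v generator (inj₂ (i , x)) (inj₂ (_ , y)) (refl , x~y) =
    lift-to-copy i (generator (inj₂ x) (inj₂ y) x~y)

mainTheorem3 : (n m : ℕ) (G : Graph (Fin n)) (H : Graph (Fin m))
    → Connected G
    → Connected H
    → Σ ℕ (λ r → IsRadius H r × 4 ≤ r)
    → (b : ℕ) → IsLocalMetricDim (K₁+ H) b
    → IsLocalMetricDim (corona G H) (n * b)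
mainTheorem3 n m G H connectedG connectedH (r , radius , 4≤r) b
             ((S , unique , generator , |S|≡b) , b-least) =
    (copies S , copies-unique unique , copies-generator centre generator
    , trans (length-copies S) (cong (n *_) |S|≡b))
  , λ S′ unique′ generator′ → lower-bound connectedG connectedH radius 4≤r b-least unique′ generator′
  where
  open Corona G H
  centre : Fin m
  centre = proj₁ (proj₁ radius)
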